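{- Let $C_{\mathbf m}$ denote the hyper-Catalan numbers (defined in the context). Then $C_{[\,]}=1$, and for every type $\mathbf m\neq[\,]$, $$C_{\mathbf m}=\sum_{j\ge 2}\ \sum_{\substack{\sum_{\mathbf n\ge 0}k_{\mathbf n}=j\\ \sum_{\mathbf n\ge 0}k_{\mathbf n}\mathbf n=\mathbf m-\vec{j}}}\binom{j}{\mathbf k}\prod_{\mathbf n\ge 0}C_{\mathbf n}^{k_{\mathbf n}},$$ where the inner sum runs over all families $\mathbf k=(k_{\mathbf n})_{\mathbf n}$ of natural numbers indexed by types $\mathbf n$, with only finitely many $k_{\mathbf n}$ nonzero, satisfying the two displayed constraints, and $\binom{j}{\mathbf k}=j!/\prod_{\mathbf n}k_{\mathbf n}!$ is the multinomial coefficient.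
   Context: A type is a vector $\mathbf m=[m_2,m_3,m_4,\ldots]$ of natural numbers (indices start at $2$) with only finitely many nonzero entries; trailing zeros are ignored and $[\,]$ is the zero vector. For $j\ge2$, $\vec{j}$ denotes the type with $1$ in position $j$ and $0$ elsewhere. Vectors are added/subtracted componentwise and scaled by natural numbers. The hyper-Catalan number $C_{\mathbf m}$ is the number of ways to subdivide a polygon with a distinguished side (the roof) by non-crossing diagonals into $m_2$ triangles, $m_3$ quadrilaterals, $m_4$ pentagons, etc.; equivalently $C_{\mathbf m}=\frac{(2m_2+3m_3+4m_4+\cdots)!}{(1+m_2+2m_3+3m_4+\cdots)!\,m_2!\,m_3!\,m_4!\cdots}$. When $\mathbf m-\vec j$ has a negative entry the inner sum is empty. -}

module Defs where

open import Data.Nat using (ℕ; zero; suc; _+_; _*_; _^_; _!; NonZero; _≟_)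
open import Data.Nat.Properties using (m*n≢0; _!≢0)
open import Data.Nat.DivMod using (_/_)
open import Data.Fin using (Fin; toℕ)
open import Data.List using (List; []; _∷_; map; concatMap; upTo; filter; zipWith; length)
open import Data.Nat.ListAction using (sum; product)
open import Data.Vec as Vec using (Vec; []; _∷_; replicate; toList)
import Data.Vec.Properties as VecP
open import Data.Maybe using (Maybe; just; nothing)
open import Data.Product using (_×_; _,_)
open import Relation.Nullary.Decidable using (_×-dec_)

-- A type m = [m₂, m₃, …] is represented by a vector of length d:
-- position i : Fin d holds m_{i+2}. Types differing only by trailing zeros
-- are identified; every type is represented for all large enough d.
Type : ℕ → Set
Type d = Vec ℕ d

wsum : ∀ {d} → ℕ → Type d → ℕ
wsum o []       = 0
wsum o (x ∷ xs) = o * x + wsum (suc o) xs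

prodFact : List ℕ → ℕ
prodFact []       = 1
prodFact (x ∷ xs) = x ! * prodFact xs

prodFact≢0 : ∀ xs → NonZero (prodFact xs)
prodFact≢0 []       = _
prodFact≢0 (x ∷ xs) = m*n≢0 (x !) (prodFact xs) {{x !≢0}} {{prodFact≢0 xs}}

HC : ∀ {d} → Type d → ℕ
HC m = ((wsum 2 m) ! / (suc (wsum 1 m) ! * prodFact (toList m)))
         {{m*n≢0 _ _ {{suc (wsum 1 m) !≢0}} {{prodFact≢0 (toList m)}}}}

multinomial : ℕ → List ℕ → ℕ
multinomial j ks = (j ! / prodFact ks) {{prodFact≢0 ks}}

-- m - vec(j), where j is given by its position i (j = toℕ i + 2);
-- nothing when the result would have a negative entry.
minusUnit : ∀ {d} → Type d → Fin d → Maybe (Type d)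
minusUnit (zero  ∷ xs) Fin.zero    = nothing
minusUnit (suc x ∷ xs) Fin.zero    = just (x ∷ xs)
minusUnit (x ∷ xs)     (Fin.suc i) with minusUnit xs i
... | just ys = just (x ∷ ys)
... | nothing = nothing

box : ∀ {d} → Type d → List (Type d)
box []       = [] ∷ []
box (r ∷ rs) = concatMap (λ a → map (a ∷_) (box rs)) (upTo (suc r))

lists≤ : ℕ → ℕ → List (List ℕ)
lists≤ j zero    = [] ∷ []
lists≤ j (suc N) = concatMap (λ a → map (a ∷_) (lists≤ j N)) (upTo (suc j))

vsum : ∀ {d} → List (Type d) → Type d
vsum {d} []       = replicate d 0
vsum     (v ∷ vs) = Vec.zipWith _+_ v (vsum vs)

weighted : ∀ {d} → List ℕ → List (Type d) → Type d
weighted ks B = vsum (zipWith (λ k n → Vec.map (k *_) n) ks B)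

-- the inner sum for a given j and r = m - vec(j): over all families
-- k = (k_n) supported on the types n ≤ r (any type with k_n > 0 in a valid
-- family satisfies n ≤ r), with Σ k_n = j and Σ k_n n = r,
-- of  multinomial(j; k) · ∏ C_n^{k_n}.
innerSum : ∀ {d} → ℕ → Type d → ℕ
innerSum j r =
  sum (map (λ ks → multinomial j ks * product (zipWith (λ k n → HC n ^ k) ks B))
           (filter (λ ks → (sum ks ≟ j) ×-dec VecP.≡-dec _≟_ (weighted ks B) r)
                   (lists≤ j (length B))))
  where B = box r

innerSum? : ∀ {d} → ℕ → Maybe (Type d) → ℕ
innerSum? j (just r) = innerSum j r
innerSum? j nothing  = 0

-- right-hand side: Σ_{j ≥ 2} (inner sum); j = toℕ i + 2 for i : Fin d
-- (for j > d + 1 the entry m_j is 0, so m - vec(j) is negative: empty sum)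
RHS : ∀ {d} → Type d → ℕ
RHS {d} m = sum (map (λ i → innerSum? (toℕ i + 2) (minusUnit m i)) (Data.List.allFin d))

-- Let S be the power series in t₂, t₃, … solving S = 1 + ∑ⱼ tⱼ Sʲ. The coefficients
-- Spow s m = [tᵐ] Sˢ satisfy Sˢ⁺¹ = Sˢ + ∑ⱼ tⱼ Sˢ⁺ʲ, which serves as their definition. Induction
-- along this recurrence proves Lagrange's closed form
--   [tᵐ] Sˢ⁺¹ · (s + 1 + ∑ⱼ (j − 1) mⱼ)! ∏ⱼ mⱼ! = (s + 1) · (s + ∑ⱼ j mⱼ)!,
-- whose case s = 0 is [tᵐ] S = Cₘ, and also Sᵃ⁺ˢ = Sᵃ Sˢ. Hence [tʳ] Sʲ is the j-fold convolution
-- power of C, which the multinomial theorem expands into the inner sum of the statement, and the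
-- recurrence at s = 0 reads Cₘ = ∑ⱼ [t^(m − eⱼ)] Sʲ for m ≠ 0.

module Submission where

open import Defs
open import Data.Nat using (ℕ; NonZero; zero; suc; _+_; _*_; _∸_; _^_; _!; _≤_; _<_; _≟_; _≤?_; pred; s≤s; z≤n)
open import Data.Nat.Properties
open import Data.Nat.Combinatorics using (_C_; k![n∸k]!∣n!; nCk≡n!/k![n-k]!; k>n⇒nCk≡0; nCk+nC[k+1]≡[n+1]C[k+1])
open import Data.Nat.Divisibility using (_∣_; ∣-refl; ∣-trans; *-monoʳ-∣)
open import Data.Nat.DivMod using (_/_; m*n/n≡m; m/n*n≡m; /-congˡ)
open import Data.Nat.ListAction using (sum; product)
open import Data.Nat.Solver using (module +-*-Solver)
open import Data.Fin using (Fin; toℕ)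
open import Data.List using (List; []; _∷_; map; _++_; concatMap; upTo; allFin; tabulate; filter; zipWith; length)
open import Data.List.Properties using (upTo-∷ʳ; map-upTo)
open import Data.List.Membership.Propositional using (_∈_)
open import Data.List.Membership.Propositional.Properties using (∈-upTo⁻)
open import Data.List.Relation.Unary.Any using (here; there)
import Data.Vec as Vec
open import Data.Vec using (Vec; []; _∷_; replicate; lookup; toList)
import Data.Vec.Properties as Vecₚ
open import Data.Vec.Relation.Binary.Pointwise.Inductive as Pointwise using (Pointwise; []; _∷_; Pointwise-≡⇒≡)
open import Data.Maybe using (Maybe; just; nothing; maybe′)
import Data.Maybe
open import Data.Maybe.Properties using (maybe′-map; maybe′-∘)
open import Data.Bool using (true; false; if_then_else_; _∧_)
open import Data.Bool.Properties using (∧-zeroʳ)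
open import Data.Empty using (⊥-elim)
open import Data.Sum using (inj₁; inj₂)
open import Data.Product using (_×_; _,_)
open import Function using (_∘_; mk⇔)
open import Relation.Nullary using (Dec; yes; no; does)
open import Relation.Nullary.Decidable using (_×-dec_; does-⇔; dec-true; dec-false)
open import Relation.Unary using (Decidable)
open import Relation.Binary.PropositionalEquality using (_≡_; _≢_; refl; sym; trans; cong; cong₂; subst; module ≡-Reasoning)

import Algebra.Properties.CommutativeSemigroup as CommSemigroupProperties

open +-*-Solver using (solve; _:+_; _:*_; _:=_; con)
open ≡-Reasoning

private
  module +-CS = CommSemigroupProperties +-commutativeSemigroup
  module *-CS = CommSemigroupProperties *-commutativeSemigroup

  variable
    A A′ : Set
    d : ℕ

-- Finite sums

∑ : List A → (A → ℕ) → ℕ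
∑ xs f = sum (map f xs)

syntax ∑ xs (λ x → e) = ∑[ x ∈ xs ] e

∑-cong-∈ : ∀ (xs : List A) {f g : A → ℕ} → (∀ {x} → x ∈ xs → f x ≡ g x) → ∑ xs f ≡ ∑ xs g
∑-cong-∈ []       eq = refl
∑-cong-∈ (x ∷ xs) eq = cong₂ _+_ (eq (here refl)) (∑-cong-∈ xs (eq ∘ there))

∑-cong : ∀ (xs : List A) {f g : A → ℕ} → (∀ x → f x ≡ g x) → ∑ xs f ≡ ∑ xs g
∑-cong xs eq = ∑-cong-∈ xs (λ {x} _ → eq x)

∑-zero : ∀ (xs : List A) {f : A → ℕ} → (∀ x → f x ≡ 0) → ∑ xs f ≡ 0
∑-zero []       eq = refl
∑-zero (x ∷ xs) eq = cong₂ _+_ (eq x) (∑-zero xs eq)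

∑-distrib-+ : ∀ (xs : List A) (f g : A → ℕ) → ∑[ x ∈ xs ] (f x + g x) ≡ ∑ xs f + ∑ xs g
∑-distrib-+ []       f g = refl
∑-distrib-+ (x ∷ xs) f g =
  trans (cong (f x + g x +_) (∑-distrib-+ xs f g)) (+-CS.interchange (f x) (g x) (∑ xs f) (∑ xs g))

*-distribˡ-∑ : ∀ (xs : List A) c (f : A → ℕ) → c * ∑ xs f ≡ ∑[ x ∈ xs ] (c * f x)
*-distribˡ-∑ []       c f = *-zeroʳ c
*-distribˡ-∑ (x ∷ xs) c f = trans (*-distribˡ-+ c (f x) (∑ xs f)) (cong (c * f x +_) (*-distribˡ-∑ xs c f))

*-distribʳ-∑ : ∀ (xs : List A) c (f : A → ℕ) → ∑ xs f * c ≡ ∑[ x ∈ xs ] (f x * c)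
*-distribʳ-∑ xs c f = trans (*-comm (∑ xs f) c) (trans (*-distribˡ-∑ xs c f) (∑-cong xs (λ x → *-comm c (f x))))

∑-comm : ∀ (xs : List A) (ys : List A′) (f : A → A′ → ℕ) →
         ∑[ x ∈ xs ] ∑ ys (f x) ≡ ∑[ y ∈ ys ] ∑[ x ∈ xs ] f x y
∑-comm []       ys f = sym (∑-zero ys (λ _ → refl))
∑-comm (x ∷ xs) ys f = trans (cong (∑ ys (f x) +_) (∑-comm xs ys f)) (sym (∑-distrib-+ ys (f x) _))

∑-++ : ∀ (xs ys : List A) f → ∑ (xs ++ ys) f ≡ ∑ xs f + ∑ ys f
∑-++ []       ys f = refl
∑-++ (x ∷ xs) ys f = trans (cong (f x +_) (∑-++ xs ys f)) (sym (+-assoc (f x) _ _))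

∑-map : ∀ (xs : List A) (g : A → A′) f → ∑ (map g xs) f ≡ ∑ xs (f ∘ g)
∑-map []       g f = refl
∑-map (x ∷ xs) g f = cong (f (g x) +_) (∑-map xs g f)

∑-concatMap : ∀ {E : Set} (xs : List A) (h : A → List E) f → ∑ (concatMap h xs) f ≡ ∑[ x ∈ xs ] ∑ (h x) f
∑-concatMap []       h f = refl
∑-concatMap (x ∷ xs) h f = trans (∑-++ (h x) (concatMap h xs) f) (cong (∑ (h x) f +_) (∑-concatMap xs h f))

∑-filter : ∀ {P : A → Set} (P? : Decidable P) (xs : List A) f →
           ∑ (filter P? xs) f ≡ ∑[ x ∈ xs ] (if does (P? x) then f x else 0)
∑-filter P? []       f = refl
∑-filter P? (x ∷ xs) f with P? x
... | yes _ = cong (f x +_) (∑-filter P? xs f)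
... | no _  = ∑-filter P? xs f

∑-concatMap-map : ∀ {E : Set} (xs : List A) (ys : List A′) (g : A → A′ → E) f →
                  ∑ (concatMap (λ a → map (g a) ys) xs) f ≡ ∑[ a ∈ xs ] ∑[ y ∈ ys ] f (g a y)
∑-concatMap-map xs ys g f = trans (∑-concatMap xs _ f) (∑-cong xs (λ a → ∑-map ys (g a) f))

∑-allFin-suc : ∀ n (f : Fin (suc n) → ℕ) → ∑ (allFin (suc n)) f ≡ f Fin.zero + ∑[ i ∈ allFin n ] f (Fin.suc i)
∑-allFin-suc n f = cong (f Fin.zero +_) (∑-tabulate n Fin.suc f)
  where
  ∑-tabulate : ∀ n (g : Fin n → A) (f : A → ℕ) → ∑ (tabulate g) f ≡ ∑ (allFin n) (f ∘ g)
  ∑-tabulate zero    g f = refl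
  ∑-tabulate (suc n) g f =
    cong (f (g Fin.zero) +_) (trans (∑-tabulate n (g ∘ Fin.suc) f) (sym (∑-tabulate n Fin.suc (f ∘ g))))

∑-upTo-suc : ∀ n (f : ℕ → ℕ) → ∑ (upTo (suc n)) f ≡ f 0 + ∑[ a ∈ upTo n ] f (suc a)
∑-upTo-suc n f = cong (f 0 +_) (trans (cong (λ xs → ∑ xs f) (sym (map-upTo suc n))) (∑-map (upTo n) suc f))

∑-upTo-last : ∀ n (f : ℕ → ℕ) → ∑ (upTo (suc n)) f ≡ ∑ (upTo n) f + f n
∑-upTo-last n f = begin
  ∑ (upTo (suc n)) f          ≡⟨ cong (λ xs → ∑ xs f) (upTo-∷ʳ n) ⟨
  ∑ (upTo n ++ n ∷ []) f      ≡⟨ ∑-++ (upTo n) (n ∷ []) f ⟩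
  ∑ (upTo n) f + (f n + 0)    ≡⟨ cong (∑ (upTo n) f +_) (+-identityʳ (f n)) ⟩
  ∑ (upTo n) f + f n          ∎

∑-upTo-cong : ∀ n {f g : ℕ → ℕ} → (∀ a → a < n → f a ≡ g a) → ∑ (upTo n) f ≡ ∑ (upTo n) g
∑-upTo-cong n eq = ∑-cong-∈ (upTo n) (λ a∈ → eq _ (∈-upTo⁻ a∈))

∑-upTo-extend : ∀ {n m} (f : ℕ → ℕ) → n ≤ m → (∀ a → n ≤ a → f a ≡ 0) → ∑ (upTo m) f ≡ ∑ (upTo n) f
∑-upTo-extend {m = zero}  f z≤n      _ = refl
∑-upTo-extend {n} {suc m} f n≤1+m vanish with m≤n⇒m<n∨m≡n n≤1+m
... | inj₂ refl       = refl
... | inj₁ (s≤s n≤m) = begin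
  ∑ (upTo (suc m)) f    ≡⟨ ∑-upTo-last m f ⟩
  ∑ (upTo m) f + f m    ≡⟨ cong₂ _+_ (∑-upTo-extend f n≤m vanish) (vanish m n≤m) ⟩
  ∑ (upTo n) f + 0      ≡⟨ +-identityʳ _ ⟩
  ∑ (upTo n) f          ∎

-- Arithmetic of types

infixl 6 _+ᵛ_ _∸ᵛ_
infixr 7 _·ᵛ_
infix  4 _≟ᵛ_ _≤ᵛ_ _≤ᵛ?_

_+ᵛ_ _∸ᵛ_ : Type d → Type d → Type d
_+ᵛ_ = Vec.zipWith _+_
_∸ᵛ_ = Vec.zipWith _∸_

_·ᵛ_ : ℕ → Type d → Type d
a ·ᵛ v = Vec.map (a *_) v

0ᵛ : Type d
0ᵛ = replicate _ 0

_≟ᵛ_ : (u v : Type d) → Dec (u ≡ v)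
_≟ᵛ_ = Vecₚ.≡-dec _≟_

_≤ᵛ_ : Type d → Type d → Set
_≤ᵛ_ = Pointwise _≤_

_≤ᵛ?_ : (u v : Type d) → Dec (u ≤ᵛ v)
_≤ᵛ?_ = Pointwise.decidable _≤?_

+ᵛ-assoc : (u v w : Type d) → (u +ᵛ v) +ᵛ w ≡ u +ᵛ (v +ᵛ w)
+ᵛ-assoc u v w = Pointwise-≡⇒≡ (Pointwise.zipWith-assoc +-assoc u v w)

+ᵛ-comm : (u v : Type d) → u +ᵛ v ≡ v +ᵛ u
+ᵛ-comm u v = Pointwise-≡⇒≡ (Pointwise.zipWith-comm +-comm u v)

+ᵛ-identityˡ : (v : Type d) → 0ᵛ +ᵛ v ≡ v
+ᵛ-identityˡ v = Pointwise-≡⇒≡ (Pointwise.zipWith-identityˡ +-identityˡ v)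

+ᵛ-identityʳ : (v : Type d) → v +ᵛ 0ᵛ ≡ v
+ᵛ-identityʳ v = Pointwise-≡⇒≡ (Pointwise.zipWith-identityʳ +-identityʳ v)

+ᵛ-cancelˡ : (u v w : Type d) → u +ᵛ v ≡ u +ᵛ w → v ≡ w
+ᵛ-cancelˡ []       []       []       _  = refl
+ᵛ-cancelˡ (x ∷ u) (y ∷ v) (z ∷ w) eq =
  cong₂ _∷_ (+-cancelˡ-≡ x y z (cong Vec.head eq)) (+ᵛ-cancelˡ u v w (cong Vec.tail eq))

∸ᵛ-identityʳ : (v : Type d) → v ∸ᵛ 0ᵛ ≡ v
∸ᵛ-identityʳ v = Pointwise-≡⇒≡ (Pointwise.zipWith-identityʳ (λ _ → refl) v)

0·ᵛ : (v : Type d) → 0 ·ᵛ v ≡ 0ᵛ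
0·ᵛ v = Vecₚ.map-const v 0

suc·ᵛ : ∀ a (v : Type d) → suc a ·ᵛ v ≡ v +ᵛ a ·ᵛ v
suc·ᵛ a []      = refl
suc·ᵛ a (x ∷ v) = cong (_ ∷_) (suc·ᵛ a v)

u+ᵛ[v∸ᵛu]≡v : {u v : Type d} → u ≤ᵛ v → u +ᵛ (v ∸ᵛ u) ≡ v
u+ᵛ[v∸ᵛu]≡v []            = refl
u+ᵛ[v∸ᵛu]≡v (x≤y ∷ u≤v) = cong₂ _∷_ (m+[n∸m]≡n x≤y) (u+ᵛ[v∸ᵛu]≡v u≤v)

u≤ᵛu+ᵛv : (u v : Type d) → u ≤ᵛ u +ᵛ v
u≤ᵛu+ᵛv []      []      = []
u≤ᵛu+ᵛv (x ∷ u) (y ∷ v) = m≤m+n x y ∷ u≤ᵛu+ᵛv u v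

∏! : Type d → ℕ
∏! t = prodFact (toList t)

minusUnit-suc : ∀ x (t : Type d) i → minusUnit (x ∷ t) (Fin.suc i) ≡ Data.Maybe.map (x ∷_) (minusUnit t i)
minusUnit-suc zero    t i with minusUnit t i
... | just _  = refl
... | nothing = refl
minusUnit-suc (suc x) t i with minusUnit t i
... | just _  = refl
... | nothing = refl

minusUnit-size : ∀ (t : Type d) i {t′} → minusUnit t i ≡ just t′ → Vec.sum t ≡ suc (Vec.sum t′)
minusUnit-size (suc x ∷ t) Fin.zero    refl = refl
minusUnit-size (x ∷ t)     (Fin.suc i) eq
  with minusUnit t i in eqᵢ | trans (sym (minusUnit-suc x t i)) eq
... | just t′ | refl = trans (cong (x +_) (minusUnit-size t i eqᵢ)) (+-suc x (Vec.sum t′))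

minusUnit-size-< : ∀ (t : Type d) i {t′ n} → Vec.sum t ≤ n → minusUnit t i ≡ just t′ → Vec.sum t′ < n
minusUnit-size-< t i {n = n} size≤n eq = subst (_≤ n) (minusUnit-size t i eq) size≤n

minusUnit-wsum : ∀ o (t : Type d) i {t′} → minusUnit t i ≡ just t′ → wsum o t ≡ (o + toℕ i) + wsum o t′
minusUnit-wsum o (suc x ∷ t) Fin.zero    refl =
  solve 3 (λ o x w → o :* (con 1 :+ x) :+ w := (o :+ con 0) :+ (o :* x :+ w)) refl o x (wsum (suc o) t)
minusUnit-wsum o (x ∷ t)     (Fin.suc i) eq
  with minusUnit t i in eqᵢ | trans (sym (minusUnit-suc x t i)) eq
... | just t′ | refl rewrite minusUnit-wsum (suc o) t i eqᵢ =
  solve 4 (λ o x k w → o :* x :+ ((con 1 :+ o :+ k) :+ w) := (o :+ (con 1 :+ k)) :+ (o :* x :+ w))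
          refl o x (toℕ i) (wsum (suc o) t′)

minusUnit-∏! : ∀ (t : Type d) i {t′} → minusUnit t i ≡ just t′ → ∏! t ≡ lookup t i * ∏! t′
minusUnit-∏! (suc x ∷ t) Fin.zero    refl = *-assoc (suc x) (x !) (∏! t)
minusUnit-∏! (x ∷ t)     (Fin.suc i) eq
  with minusUnit t i in eqᵢ | trans (sym (minusUnit-suc x t i)) eq
... | just t′ | refl rewrite minusUnit-∏! t i eqᵢ = *-CS.x∙yz≈y∙xz (x !) (lookup t i) (∏! t′)

minusUnit-nothing : ∀ (t : Type d) i → minusUnit t i ≡ nothing → lookup t i ≡ 0
minusUnit-nothing (zero ∷ t) Fin.zero    _  = refl
minusUnit-nothing (x ∷ t)    (Fin.suc i) eq
  with minusUnit t i in eqᵢ | trans (sym (minusUnit-suc x t i)) eq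
... | nothing | refl = minusUnit-nothing t i eqᵢ

maybe′-∑ : ∀ (m : Maybe A) (xs : List A′) (f : A → A′ → ℕ) →
           maybe′ (λ x → ∑ xs (f x)) 0 m ≡ ∑[ y ∈ xs ] maybe′ (λ x → f x y) 0 m
maybe′-∑ (just x) xs f = refl
maybe′-∑ nothing  xs f = sym (∑-zero xs (λ _ → refl))

maybe′-minusUnit-suc : ∀ (h : Type (suc d) → ℕ) x t i →
                       maybe′ h 0 (minusUnit (x ∷ t) (Fin.suc i)) ≡ maybe′ (h ∘ (x ∷_)) 0 (minusUnit t i)
maybe′-minusUnit-suc h x t i = trans (cong (maybe′ h 0) (minusUnit-suc x t i)) (maybe′-map h 0 (x ∷_) (minusUnit t i))

maybe′-cong : ∀ (m : Maybe A) {f g : A → ℕ} → (∀ x → f x ≡ g x) → maybe′ f 0 m ≡ maybe′ g 0 m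
maybe′-cong (just x) eq = eq x
maybe′-cong nothing  eq = refl

wsum-+ : ∀ k o (t : Type d) → wsum (k + o) t ≡ k * Vec.sum t + wsum o t
wsum-+ k o []      = sym (trans (+-identityʳ (k * 0)) (*-zeroʳ k))
wsum-+ k o (x ∷ t) = begin
  (k + o) * x + wsum (suc (k + o)) t           ≡⟨ cong (λ p → (k + o) * x + wsum p t) (+-suc k o) ⟨
  (k + o) * x + wsum (k + suc o) t             ≡⟨ cong ((k + o) * x +_) (wsum-+ k (suc o) t) ⟩
  (k + o) * x + (k * Vec.sum t + wsum (suc o) t)
    ≡⟨ solve 5 (λ k o x s w → (k :+ o) :* x :+ (k :* s :+ w) := k :* (x :+ s) :+ (o :* x :+ w))
               refl k o x (Vec.sum t) (wsum (suc o) t) ⟩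
  k * (x + Vec.sum t) + (o * x + wsum (suc o) t) ∎

∑-lookup-wsum : ∀ o (t : Type d) → ∑[ i ∈ allFin d ] (lookup t i * (o + toℕ i)) ≡ wsum o t
∑-lookup-wsum o []          = refl
∑-lookup-wsum o (x ∷ t) = begin
  ∑[ i ∈ allFin _ ] (lookup (x ∷ t) i * (o + toℕ i))
    ≡⟨ ∑-allFin-suc _ (λ i → lookup (x ∷ t) i * (o + toℕ i)) ⟩
  x * (o + 0) + ∑[ i ∈ allFin _ ] (lookup t i * (o + suc (toℕ i)))
    ≡⟨ cong₂ _+_ (trans (cong (x *_) (+-identityʳ o)) (*-comm x o))
                 (∑-cong (allFin _) (λ i → cong (lookup t i *_) (+-suc o (toℕ i)))) ⟩
  o * x + ∑[ i ∈ allFin _ ] (lookup t i * (suc o + toℕ i))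
    ≡⟨ cong (o * x +_) (∑-lookup-wsum (suc o) t) ⟩
  o * x + wsum (suc o) t ∎

wsum-0ᵛ : ∀ d o → wsum o (0ᵛ {d}) ≡ 0
wsum-0ᵛ zero    o = refl
wsum-0ᵛ (suc d) o = trans (cong (_+ wsum (suc o) (0ᵛ {d})) (*-zeroʳ o)) (wsum-0ᵛ d (suc o))

∏!-0ᵛ : ∀ d → ∏! (0ᵛ {d}) ≡ 1
∏!-0ᵛ zero    = refl
∏!-0ᵛ (suc d) = trans (+-identityʳ (∏! (0ᵛ {d}))) (∏!-0ᵛ d)

wsum≡0⇒≡0ᵛ : ∀ o (t : Type d) → wsum (suc o) t ≡ 0 → t ≡ 0ᵛ
wsum≡0⇒≡0ᵛ o []      _  = refl
wsum≡0⇒≡0ᵛ o (x ∷ t) eq =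
  cong₂ _∷_ (m+n≡0⇒m≡0 x (m+n≡0⇒m≡0 _ eq)) (wsum≡0⇒≡0ᵛ (suc o) t (m+n≡0⇒n≡0 (suc o * x) eq))

∑-box-∷ : ∀ r (rs : Type d) f → ∑ (box (r ∷ rs)) f ≡ ∑[ a ∈ upTo (suc r) ] ∑[ v ∈ box rs ] f (a ∷ v)
∑-box-∷ r rs f = ∑-concatMap-map (upTo (suc r)) (box rs) _∷_ f

∑-box-supported-0ᵛ : ∀ (t : Type d) f → (∀ x → x ≢ 0ᵛ → f x ≡ 0) → ∑ (box t) f ≡ f 0ᵛ
∑-box-supported-0ᵛ []        f _      = +-identityʳ (f [])
∑-box-supported-0ᵛ (t₀ ∷ ts) f vanish = begin
  ∑ (box (t₀ ∷ ts)) f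
    ≡⟨ trans (∑-box-∷ t₀ ts f) (∑-upTo-suc t₀ _) ⟩
  ∑[ v ∈ box ts ] f (0 ∷ v) + ∑[ a ∈ upTo t₀ ] ∑[ v ∈ box ts ] f (suc a ∷ v)
    ≡⟨ cong₂ _+_ (∑-box-supported-0ᵛ ts (f ∘ (0 ∷_)) (λ v v≢0 → vanish (0 ∷ v) (v≢0 ∘ cong Vec.tail)))
                 (∑-zero (upTo t₀) (λ a → ∑-zero (box ts) (λ v → vanish (suc a ∷ v) (λ ()))) ) ⟩
  f 0ᵛ + 0
    ≡⟨ +-identityʳ (f 0ᵛ) ⟩
  f 0ᵛ ∎

-- x ↦ x − eᵢ maps the types x ≤ t with xᵢ ≥ 1 bijectively onto box (t − eᵢ), preserving t − x.
∑-box-minusUnit : ∀ (t : Type d) i (g : Type d → Type d → ℕ) →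
                  ∑[ x ∈ box t ] maybe′ (λ y → g y (t ∸ᵛ x)) 0 (minusUnit x i)
                  ≡ maybe′ (λ t′ → ∑[ y ∈ box t′ ] g y (t′ ∸ᵛ y)) 0 (minusUnit t i)
∑-box-minusUnit (zero ∷ ts) Fin.zero g =
  trans (∑-box-∷ 0 ts _) (trans (+-identityʳ _) (∑-zero (box ts) (λ _ → refl)))
∑-box-minusUnit (suc t₀ ∷ ts) Fin.zero g = begin
  ∑[ x ∈ box (suc t₀ ∷ ts) ] maybe′ (λ y → g y ((suc t₀ ∷ ts) ∸ᵛ x)) 0 (minusUnit x Fin.zero)
    ≡⟨ trans (∑-box-∷ (suc t₀) ts _) (∑-upTo-suc (suc t₀) (λ a → ∑[ v ∈ box ts ] summand (a ∷ v))) ⟩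
  ∑[ v ∈ box ts ] 0 + ∑[ a ∈ upTo (suc t₀) ] ∑[ v ∈ box ts ] g (a ∷ v) ((t₀ ∸ a) ∷ (ts ∸ᵛ v))
    ≡⟨ cong (_+ ∑[ a ∈ upTo (suc t₀) ] ∑[ v ∈ box ts ] reduced (a ∷ v)) (∑-zero (box ts) (λ _ → refl)) ⟩
  ∑[ a ∈ upTo (suc t₀) ] ∑[ v ∈ box ts ] g (a ∷ v) ((t₀ ∸ a) ∷ (ts ∸ᵛ v))
    ≡⟨ ∑-box-∷ t₀ ts reduced ⟨
  ∑[ y ∈ box (t₀ ∷ ts) ] g y ((t₀ ∷ ts) ∸ᵛ y) ∎
  where
  summand : Type _ → ℕ
  summand x = maybe′ (λ y → g y ((suc t₀ ∷ ts) ∸ᵛ x)) 0 (minusUnit x Fin.zero)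
  reduced : Type _ → ℕ
  reduced y = g y ((t₀ ∷ ts) ∸ᵛ y)
∑-box-minusUnit (t₀ ∷ ts) (Fin.suc i) g = begin
  ∑[ x ∈ box (t₀ ∷ ts) ] maybe′ (λ y → g y ((t₀ ∷ ts) ∸ᵛ x)) 0 (minusUnit x (Fin.suc i))
    ≡⟨ ∑-box-∷ t₀ ts _ ⟩
  ∑[ a ∈ upTo (suc t₀) ] ∑[ v ∈ box ts ]
    maybe′ (λ y → g y ((t₀ ∷ ts) ∸ᵛ (a ∷ v))) 0 (minusUnit (a ∷ v) (Fin.suc i))
    ≡⟨ ∑-cong (upTo (suc t₀)) (λ a → ∑-cong (box ts) (λ v → maybe′-minusUnit-suc _ a v i)) ⟩
  ∑[ a ∈ upTo (suc t₀) ] ∑[ v ∈ box ts ] maybe′ (λ y → g (a ∷ y) ((t₀ ∸ a) ∷ (ts ∸ᵛ v))) 0 (minusUnit v i)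
    ≡⟨ ∑-cong (upTo (suc t₀)) (λ a → ∑-box-minusUnit ts i (λ y z → g (a ∷ y) ((t₀ ∸ a) ∷ z))) ⟩
  ∑[ a ∈ upTo (suc t₀) ] maybe′ (λ t′ → ∑[ y ∈ box t′ ] g (a ∷ y) ((t₀ ∸ a) ∷ (t′ ∸ᵛ y))) 0 (minusUnit ts i)
    ≡⟨ maybe′-∑ (minusUnit ts i) (upTo (suc t₀)) _ ⟨
  maybe′ (λ t′ → ∑[ a ∈ upTo (suc t₀) ] ∑[ y ∈ box t′ ] g (a ∷ y) ((t₀ ∸ a) ∷ (t′ ∸ᵛ y))) 0 (minusUnit ts i)
    ≡⟨ maybe′-cong (minusUnit ts i) (λ t′ → ∑-box-∷ t₀ t′ _) ⟨
  maybe′ (λ t′ → ∑[ y ∈ box (t₀ ∷ t′) ] g y ((t₀ ∷ t′) ∸ᵛ y)) 0 (minusUnit ts i)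
    ≡⟨ maybe′-minusUnit-suc _ t₀ ts i ⟨
  maybe′ (λ t′ → ∑[ y ∈ box t′ ] g y (t′ ∸ᵛ y)) 0 (minusUnit (t₀ ∷ ts) (Fin.suc i)) ∎

∑-box-≤ᵛ : ∀ {r t : Type d} → t ≤ᵛ r → (g : Type d → ℕ) →
           ∑[ b ∈ box r ] (if does (b ≤ᵛ? t) then g b else 0) ≡ ∑ (box t) g
∑-box-≤ᵛ {r = []}     {[]}     []                g = refl
∑-box-≤ᵛ {r = r₀ ∷ rs} {t₀ ∷ ts} (t₀≤r₀ ∷ ts≤rs) g = begin
  ∑[ b ∈ box (r₀ ∷ rs) ] (if does (b ≤ᵛ? t₀ ∷ ts) then g b else 0)
    ≡⟨ ∑-box-∷ r₀ rs _ ⟩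
  ∑[ a ∈ upTo (suc r₀) ] ∑[ v ∈ box rs ] (if does (a ≤? t₀) ∧ does (v ≤ᵛ? ts) then g (a ∷ v) else 0)
    ≡⟨ ∑-cong (upTo (suc r₀)) column ⟩
  ∑ (upTo (suc r₀)) restricted
    ≡⟨ ∑-upTo-extend restricted (s≤s t₀≤r₀) beyond ⟩
  ∑ (upTo (suc t₀)) restricted
    ≡⟨ ∑-upTo-cong (suc t₀) within ⟩
  ∑[ a ∈ upTo (suc t₀) ] ∑[ v ∈ box ts ] g (a ∷ v)
    ≡⟨ ∑-box-∷ t₀ ts g ⟨
  ∑ (box (t₀ ∷ ts)) g ∎
  where
  restricted : ℕ → ℕ
  restricted a = if does (a ≤? t₀) then ∑[ v ∈ box ts ] g (a ∷ v) else 0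

  column : ∀ a → ∑[ v ∈ box rs ] (if does (a ≤? t₀) ∧ does (v ≤ᵛ? ts) then g (a ∷ v) else 0) ≡ restricted a
  column a with does (a ≤? t₀)
  ... | true  = ∑-box-≤ᵛ ts≤rs (g ∘ (a ∷_))
  ... | false = ∑-zero (box rs) (λ _ → refl)

  beyond : ∀ a → suc t₀ ≤ a → restricted a ≡ 0
  beyond a t₀<a rewrite dec-false (a ≤? t₀) (<⇒≱ t₀<a) = refl

  within : ∀ a → a < suc t₀ → restricted a ≡ ∑[ v ∈ box ts ] g (a ∷ v)
  within a a<1+t₀ rewrite dec-true (a ≤? t₀) (≤-pred a<1+t₀) = refl

-- Powers of the hyper-Catalan series

-- The fuel bounds the number of polygons of m, which drops in the second summand.
Spowᶠ : ℕ → ℕ → Type d → ℕ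
Spowᶠ zero    s       t = 0
Spowᶠ (suc n) zero    t = if does (t ≟ᵛ 0ᵛ) then 1 else 0
Spowᶠ (suc n) (suc s) t =
  Spowᶠ (suc n) s t + ∑[ i ∈ allFin _ ] maybe′ (Spowᶠ n (s + (toℕ i + 2))) 0 (minusUnit t i)

Spow : ℕ → Type d → ℕ
Spow s t = Spowᶠ (suc (Vec.sum t)) s t

Spow-suc : ∀ s (t : Type d) →
           Spow (suc s) t ≡ Spow s t + ∑[ i ∈ allFin d ] maybe′ (Spow (s + (toℕ i + 2))) 0 (minusUnit t i)
Spow-suc s t = cong (Spow s t +_) (∑-cong (allFin _) enoughFuel)
  where
  enoughFuel : ∀ i → maybe′ (Spowᶠ (Vec.sum t) (s + (toℕ i + 2))) 0 (minusUnit t i)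
                     ≡ maybe′ (Spow (s + (toℕ i + 2))) 0 (minusUnit t i)
  enoughFuel i with minusUnit t i in eq
  ... | just t′ rewrite minusUnit-size t i eq = refl
  ... | nothing = refl

Spow-0-0ᵛ : Spow 0 (0ᵛ {d}) ≡ 1
Spow-0-0ᵛ {d} = cong (if_then 1 else 0) (dec-true (0ᵛ {d} ≟ᵛ 0ᵛ) refl)

Spow-0-≢0ᵛ : ∀ {t : Type d} → t ≢ 0ᵛ → Spow 0 t ≡ 0
Spow-0-≢0ᵛ {t = t} t≢0 = cong (if_then 1 else 0) (dec-false (t ≟ᵛ 0ᵛ) t≢0)

n*[pred-n]!≡n! : ∀ {n} → n ≢ 0 → n * pred n ! ≡ n !
n*[pred-n]!≡n! {zero}  n≢0 = ⊥-elim (n≢0 refl)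
n*[pred-n]!≡n! {suc n} _   = refl

SpowClosedForm : ℕ → Type d → Set
SpowClosedForm s t = Spow (suc s) t * ((suc s + wsum 1 t) ! * ∏! t) ≡ suc s * (s + wsum 2 t) !

ClosedBelow : Type d → Set
ClosedBelow t = ∀ i {t′} → minusUnit t i ≡ just t′ → ∀ s → SpowClosedForm s t′

Spow-removal-term : ∀ s (t : Type d) i → ClosedBelow t →
                    maybe′ (Spow (s + (toℕ i + 2))) 0 (minusUnit t i) * ((suc s + wsum 1 t) ! * ∏! t)
                    ≡ lookup t i * ((s + 2) + toℕ i) * pred (s + wsum 2 t) !
Spow-removal-term s t i below with minusUnit t i in eq
... | nothing rewrite minusUnit-nothing t i eq = refl
... | just t′ = begin
  Spow (s + (toℕ i + 2)) t′ * ((suc s + wsum 1 t) ! * ∏! t)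
    ≡⟨ cong₂ (λ a b → Spow a t′ * b) removed (cong₂ _*_ (cong _! denominator) (minusUnit-∏! t i eq)) ⟩
  Spow (suc k) t′ * ((suc k + wsum 1 t′) ! * (L * ∏! t′))
    ≡⟨ solve 4 (λ L f a b → f :* (a :* (L :* b)) := L :* (f :* (a :* b)))
               refl L (Spow (suc k) t′) ((suc k + wsum 1 t′) !) (∏! t′) ⟩
  L * (Spow (suc k) t′ * ((suc k + wsum 1 t′) ! * ∏! t′))
    ≡⟨ cong (L *_) (below i eq k) ⟩
  L * (suc k * (k + wsum 2 t′) !)
    ≡⟨ *-assoc L (suc k) _ ⟨
  L * suc k * (k + wsum 2 t′) !
    ≡⟨ cong₂ (λ a b → L * a * b !) reindexed (sym numerator) ⟩
  L * ((s + 2) + toℕ i) * pred (s + wsum 2 t) ! ∎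
  where
  L = lookup t i
  k = s + suc (toℕ i)
  removed : s + (toℕ i + 2) ≡ suc k
  removed = solve 2 (λ s i → s :+ (i :+ con 2) := con 1 :+ (s :+ (con 1 :+ i))) refl s (toℕ i)
  reindexed : suc k ≡ (s + 2) + toℕ i
  reindexed = solve 2 (λ s i → con 1 :+ (s :+ (con 1 :+ i)) := (s :+ con 2) :+ i) refl s (toℕ i)
  denominator : suc s + wsum 1 t ≡ suc k + wsum 1 t′
  denominator rewrite minusUnit-wsum 1 t i eq =
    solve 3 (λ s i w → con 1 :+ s :+ ((con 1 :+ i) :+ w) := con 1 :+ (s :+ (con 1 :+ i)) :+ w) refl s (toℕ i) (wsum 1 t′)
  numerator : pred (s + wsum 2 t) ≡ k + wsum 2 t′
  numerator rewrite minusUnit-wsum 2 t i eq =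
    cong pred (solve 3 (λ s i w → s :+ ((con 2 :+ i) :+ w) := con 1 :+ (s :+ (con 1 :+ i) :+ w)) refl s (toℕ i) (wsum 2 t′))

-- When t = 0ᵛ the left factor vanishes, so the truncated predecessor is harmless.
∑-removal-terms : ∀ s (t : Type d) → ClosedBelow t →
                  (∑[ i ∈ allFin d ] maybe′ (Spow (s + (toℕ i + 2))) 0 (minusUnit t i)) * ((suc s + wsum 1 t) ! * ∏! t)
                  ≡ (s * Vec.sum t + wsum 2 t) * pred (s + wsum 2 t) !
∑-removal-terms {d} s t below = begin
  (∑[ i ∈ allFin d ] maybe′ (Spow (s + (toℕ i + 2))) 0 (minusUnit t i)) * D
    ≡⟨ *-distribʳ-∑ (allFin d) D _ ⟩
  ∑[ i ∈ allFin d ] (maybe′ (Spow (s + (toℕ i + 2))) 0 (minusUnit t i) * D)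
    ≡⟨ ∑-cong (allFin d) (λ i → Spow-removal-term s t i below) ⟩
  ∑[ i ∈ allFin d ] (lookup t i * ((s + 2) + toℕ i) * X)
    ≡⟨ *-distribʳ-∑ (allFin d) X _ ⟨
  (∑[ i ∈ allFin d ] (lookup t i * ((s + 2) + toℕ i))) * X
    ≡⟨ cong (_* X) (trans (∑-lookup-wsum (s + 2) t) (wsum-+ s 2 t)) ⟩
  (s * Vec.sum t + wsum 2 t) * X ∎
  where
  D = (suc s + wsum 1 t) ! * ∏! t
  X = pred (s + wsum 2 t) !

Spow-closed-zero : ∀ (t : Type d) → ClosedBelow t → SpowClosedForm 0 t
Spow-closed-zero {d} t below = begin
  Spow 1 t * D                                ≡⟨ cong (_* D) (Spow-suc 0 t) ⟩
  (Spow 0 t + Σ) * D                          ≡⟨ *-distribʳ-+ D (Spow 0 t) Σ ⟩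
  Spow 0 t * D + Σ * D                        ≡⟨ cong (Spow 0 t * D +_) (∑-removal-terms 0 t below) ⟩
  Spow 0 t * D + wsum 2 t * pred (wsum 2 t) ! ≡⟨ emptyOrNot (t ≟ᵛ 0ᵛ) ⟩
  1 * wsum 2 t !                              ∎
  where
  D = (1 + wsum 1 t) ! * ∏! t
  Σ = ∑[ i ∈ allFin d ] maybe′ (Spow (toℕ i + 2)) 0 (minusUnit t i)

  emptyOrNot : Dec (t ≡ 0ᵛ) →
               Spow 0 t * ((1 + wsum 1 t) ! * ∏! t) + wsum 2 t * pred (wsum 2 t) ! ≡ 1 * wsum 2 t !
  emptyOrNot (yes t≡0) rewrite t≡0 | Spow-0-0ᵛ {d} | wsum-0ᵛ d 1 | wsum-0ᵛ d 2 | ∏!-0ᵛ d = refl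
  emptyOrNot (no t≢0)  rewrite Spow-0-≢0ᵛ t≢0 =
    trans (n*[pred-n]!≡n! (t≢0 ∘ wsum≡0⇒≡0ᵛ 1 t)) (sym (*-identityˡ _))

Spow-closed-suc : ∀ s (t : Type d) → ClosedBelow t → SpowClosedForm s t → SpowClosedForm (suc s) t
Spow-closed-suc {d} s t below closed = begin
  Spow (2 + s) t * D′                                   ≡⟨ cong (_* D′) (Spow-suc (suc s) t) ⟩
  (Spow (suc s) t + Σ) * D′                             ≡⟨ *-distribʳ-+ D′ (Spow (suc s) t) Σ ⟩
  Spow (suc s) t * D′ + Σ * D′                          ≡⟨ cong₂ _+_ grow (∑-removal-terms (suc s) t below) ⟩
  (2 + s + W₁) * (suc s * (s + W₂) !) + (suc s * N + W₂) * (s + W₂) !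
    ≡⟨ cong (λ w → (2 + s + W₁) * (suc s * (s + w) !) + (suc s * N + w) * (s + w) !) W₂≡N+W₁ ⟩
  (2 + s + W₁) * (suc s * (s + (N + W₁)) !) + (suc s * N + (N + W₁)) * (s + (N + W₁)) !
    ≡⟨ solve 4 (λ s w m x → (con 2 :+ s :+ w) :* ((con 1 :+ s) :* x) :+ ((con 1 :+ s) :* m :+ (m :+ w)) :* x
                            := (con 2 :+ s) :* ((con 1 :+ (s :+ (m :+ w))) :* x))
               refl s W₁ N ((s + (N + W₁)) !) ⟩
  (2 + s) * (suc s + (N + W₁)) !                        ≡⟨ cong (λ w → (2 + s) * (suc s + w) !) W₂≡N+W₁ ⟨
  (2 + s) * (suc s + W₂) !                              ∎
  where
  N  = Vec.sum t
  W₁ = wsum 1 t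
  W₂ = wsum 2 t
  D′ = (2 + s + W₁) ! * ∏! t
  Σ  = ∑[ i ∈ allFin d ] maybe′ (Spow (suc s + (toℕ i + 2))) 0 (minusUnit t i)

  W₂≡N+W₁ : W₂ ≡ N + W₁
  W₂≡N+W₁ = trans (wsum-+ 1 1 t) (cong (_+ W₁) (*-identityˡ N))

  grow : Spow (suc s) t * D′ ≡ (2 + s + W₁) * (suc s * (s + W₂) !)
  grow = begin
    Spow (suc s) t * ((2 + s + W₁) * (1 + s + W₁) ! * ∏! t)
      ≡⟨ solve 4 (λ f a b c → f :* (a :* b :* c) := a :* (f :* (b :* c)))
                 refl (Spow (suc s) t) (2 + s + W₁) ((1 + s + W₁) !) (∏! t) ⟩
    (2 + s + W₁) * (Spow (suc s) t * ((1 + s + W₁) ! * ∏! t))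
      ≡⟨ cong ((2 + s + W₁) *_) closed ⟩
    (2 + s + W₁) * (suc s * (s + W₂) !) ∎

Spow-closed : ∀ s (t : Type d) → SpowClosedForm s t
Spow-closed {d} s t = bounded (suc (Vec.sum t)) s t ≤-refl
  where
  bounded : ∀ n s (t : Type d) → Vec.sum t < n → SpowClosedForm s t
  bounded (suc n) zero    t (s≤s size≤n) =
    Spow-closed-zero t (λ i eq s′ → bounded n s′ _ (minusUnit-size-< t i size≤n eq))
  bounded (suc n) (suc s) t (s≤s size≤n) =
    Spow-closed-suc s t (λ i eq s′ → bounded n s′ _ (minusUnit-size-< t i size≤n eq))
                        (bounded (suc n) s t (s≤s size≤n))

HC≡Spow1 : ∀ (m : Type d) → HC m ≡ Spow 1 m
HC≡Spow1 m = begin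
  HC m                  ≡⟨ /-congˡ (trans (Spow-closed 0 m) (*-identityˡ _)) ⟨
  (Spow 1 m * D) / D    ≡⟨ m*n/n≡m (Spow 1 m) D ⟩
  Spow 1 m              ∎
  where
  D = suc (wsum 1 m) ! * ∏! m
  instance
    D≢0 : NonZero D
    D≢0 = m*n≢0 _ _ {{suc (wsum 1 m) !≢0}} {{prodFact≢0 (toList m)}}

Convolves : ℕ → ℕ → Type d → Set
Convolves a s t = Spow (a + s) t ≡ ∑[ x ∈ box t ] (Spow a x * Spow s (t ∸ᵛ x))

Convolves-zero : ∀ s (t : Type d) → Convolves 0 s t
Convolves-zero {d} s t = sym (begin
  ∑[ x ∈ box t ] (Spow 0 x * Spow s (t ∸ᵛ x))
    ≡⟨ ∑-box-supported-0ᵛ t _ (λ x x≢0 → cong (_* Spow s (t ∸ᵛ x)) (Spow-0-≢0ᵛ x≢0)) ⟩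
  Spow 0 (0ᵛ {d}) * Spow s (t ∸ᵛ 0ᵛ)
    ≡⟨ cong₂ _*_ (Spow-0-0ᵛ {d}) (cong (Spow s) (∸ᵛ-identityʳ t)) ⟩
  1 * Spow s t
    ≡⟨ *-identityˡ (Spow s t) ⟩
  Spow s t ∎)

Spow-suc-convolved : ∀ a s (t x : Type d) →
  Spow (suc a) x * Spow s (t ∸ᵛ x)
  ≡ Spow a x * Spow s (t ∸ᵛ x)
    + ∑[ i ∈ allFin d ] maybe′ (λ y → Spow (a + (toℕ i + 2)) y * Spow s (t ∸ᵛ x)) 0 (minusUnit x i)
Spow-suc-convolved {d} a s t x = begin
  Spow (suc a) x * c
    ≡⟨ cong (_* c) (Spow-suc a x) ⟩
  (Spow a x + ∑[ i ∈ allFin d ] maybe′ (Spow (a + (toℕ i + 2))) 0 (minusUnit x i)) * c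
    ≡⟨ *-distribʳ-+ c (Spow a x) _ ⟩
  Spow a x * c + (∑[ i ∈ allFin d ] maybe′ (Spow (a + (toℕ i + 2))) 0 (minusUnit x i)) * c
    ≡⟨ cong (Spow a x * c +_) (*-distribʳ-∑ (allFin d) c _) ⟩
  Spow a x * c + ∑[ i ∈ allFin d ] (maybe′ (Spow (a + (toℕ i + 2))) 0 (minusUnit x i) * c)
    ≡⟨ cong (Spow a x * c +_) (∑-cong (allFin d) (λ i → maybe′-∘ (_* c) (Spow (a + (toℕ i + 2))) (minusUnit x i))) ⟩
  Spow a x * c + ∑[ i ∈ allFin d ] maybe′ (λ y → Spow (a + (toℕ i + 2)) y * c) 0 (minusUnit x i) ∎
  where
  c = Spow s (t ∸ᵛ x)

Convolves-suc : ∀ a s (t : Type d) →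
                (∀ i {t′} → minusUnit t i ≡ just t′ → ∀ a′ → Convolves a′ s t′) →
                Convolves a s t → Convolves (suc a) s t
Convolves-suc {d} a s t below conv = begin
  Spow (suc (a + s)) t
    ≡⟨ Spow-suc (a + s) t ⟩
  Spow (a + s) t + ∑[ i ∈ allFin d ] maybe′ (Spow (a + s + (toℕ i + 2))) 0 (minusUnit t i)
    ≡⟨ cong₂ _+_ conv (∑-cong (allFin d) removed) ⟩
  ∑[ x ∈ box t ] f x + ∑[ i ∈ allFin d ] maybe′ (λ t′ → ∑[ y ∈ box t′ ] g i y (t′ ∸ᵛ y)) 0 (minusUnit t i)
    ≡⟨ cong (∑[ x ∈ box t ] f x +_) (∑-cong (allFin d) (λ i → ∑-box-minusUnit t i (g i))) ⟨
  ∑[ x ∈ box t ] f x + ∑[ i ∈ allFin d ] ∑[ x ∈ box t ] maybe′ (λ y → g i y (t ∸ᵛ x)) 0 (minusUnit x i)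
    ≡⟨ cong (∑[ x ∈ box t ] f x +_) (∑-comm (allFin d) (box t) _) ⟩
  ∑[ x ∈ box t ] f x + ∑[ x ∈ box t ] ∑[ i ∈ allFin d ] maybe′ (λ y → g i y (t ∸ᵛ x)) 0 (minusUnit x i)
    ≡⟨ ∑-distrib-+ (box t) f _ ⟨
  ∑[ x ∈ box t ] (f x + ∑[ i ∈ allFin d ] maybe′ (λ y → g i y (t ∸ᵛ x)) 0 (minusUnit x i))
    ≡⟨ ∑-cong (box t) (λ x → Spow-suc-convolved a s t x) ⟨
  ∑[ x ∈ box t ] (Spow (suc a) x * Spow s (t ∸ᵛ x)) ∎
  where
  f : Type d → ℕ
  f x = Spow a x * Spow s (t ∸ᵛ x)
  g : Fin d → Type d → Type d → ℕ
  g i y z = Spow (a + (toℕ i + 2)) y * Spow s z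

  removed : ∀ i → maybe′ (Spow (a + s + (toℕ i + 2))) 0 (minusUnit t i)
                  ≡ maybe′ (λ t′ → ∑[ y ∈ box t′ ] g i y (t′ ∸ᵛ y)) 0 (minusUnit t i)
  removed i with minusUnit t i in eq
  ... | nothing = refl
  ... | just t′ = trans (cong (λ n → Spow n t′) (+-CS.xy∙z≈xz∙y a s (toℕ i + 2))) (below i eq (a + (toℕ i + 2)))

Spow-+ : ∀ a s (t : Type d) → Convolves a s t
Spow-+ {d} a s t = bounded (suc (Vec.sum t)) a t ≤-refl
  where
  bounded : ∀ n a (t : Type d) → Vec.sum t < n → Convolves a s t
  bounded (suc n) zero    t _              = Convolves-zero s t
  bounded (suc n) (suc a) t (s≤s size≤n) =
    Convolves-suc a s t (λ i eq a′ → bounded n a′ _ (minusUnit-size-< t i size≤n eq))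
                        (bounded (suc n) a t (s≤s size≤n))

-- The multinomial expansion

nCk*[k!*[n∸k]!]≡n! : ∀ {n k} → k ≤ n → (n C k) * (k ! * (n ∸ k) !) ≡ n !
nCk*[k!*[n∸k]!]≡n! {n} {k} k≤n =
  trans (cong (_* (k ! * (n ∸ k) !)) (nCk≡n!/k![n-k]! k≤n)) (m/n*n≡m {{k !* (n ∸ k) !≢0}} (k![n∸k]!∣n! k≤n))

prodFact∣sum! : ∀ ks → prodFact ks ∣ sum ks !
prodFact∣sum! []       = ∣-refl
prodFact∣sum! (a ∷ ks) = ∣-trans (*-monoʳ-∣ (a !) (prodFact∣sum! ks)) a!b!∣[a+b]!
  where
  a!b!∣[a+b]! : a ! * sum ks ! ∣ (a + sum ks) !
  a!b!∣[a+b]! = subst (λ n → a ! * n ! ∣ (a + sum ks) !) (m+n∸m≡n a (sum ks)) (k![n∸k]!∣n! (m≤m+n a (sum ks)))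

multinomial-∷ : ∀ {s a} ks → a ≤ s → sum ks ≡ s ∸ a → multinomial s (a ∷ ks) ≡ (s C a) * multinomial (s ∸ a) ks
multinomial-∷ {s} {a} ks a≤s ks-sum = begin
  multinomial s (a ∷ ks)                 ≡⟨ /-congˡ factorials ⟨
  ((s C a) * M * (a ! * P)) / (a ! * P)  ≡⟨ m*n/n≡m ((s C a) * M) (a ! * P) ⟩
  (s C a) * M                            ∎
  where
  P = prodFact ks
  M = multinomial (s ∸ a) ks
  instance
    P≢0 : NonZero P
    P≢0 = prodFact≢0 ks
    a!P≢0 : NonZero (a ! * P)
    a!P≢0 = m*n≢0 (a !) P {{a !≢0}}

  factorials : (s C a) * M * (a ! * P) ≡ s !
  factorials = begin
    (s C a) * M * (a ! * P)
      ≡⟨ solve 4 (λ c m f p → c :* m :* (f :* p) := c :* (f :* (m :* p))) refl (s C a) M (a !) P ⟩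
    (s C a) * (a ! * (M * P))
      ≡⟨ cong (λ n → (s C a) * (a ! * n)) (m/n*n≡m (subst (λ n → P ∣ n !) ks-sum (prodFact∣sum! ks))) ⟩
    (s C a) * (a ! * (s ∸ a) !)
      ≡⟨ nCk*[k!*[n∸k]!]≡n! a≤s ⟩
    s ! ∎

-- powerCoeff B s c r is the coefficient of xʳ in xᶜ (∑_{b ∈ B} C_b xᵇ)ˢ, expanded by the binomial
-- theorem one element of B at a time.
powerCoeff : List (Type d) → ℕ → Type d → Type d → ℕ
powerCoeff []      s c r = if does ((0 ≟ s) ×-dec (c ≟ᵛ r)) then 1 else 0
powerCoeff (b ∷ B) s c r = ∑[ a ∈ upTo (suc s) ] ((s C a) * (HC b ^ a * powerCoeff B (s ∸ a) (c +ᵛ a ·ᵛ b) r))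

+ᵛ-0·ᵛ : (c v : Type d) → c +ᵛ 0 ·ᵛ v ≡ c
+ᵛ-0·ᵛ c v = trans (cong (c +ᵛ_) (0·ᵛ v)) (+ᵛ-identityʳ c)

powerCoeff-∷-zeroth : ∀ b B s (c r : Type d) →
                      1 * (HC b ^ 0 * powerCoeff B s (c +ᵛ 0 ·ᵛ b) r) ≡ powerCoeff B s c r
powerCoeff-∷-zeroth b B s c r =
  trans (*-identityˡ _) (trans (*-identityˡ _) (cong (λ v → powerCoeff B s v r) (+ᵛ-0·ᵛ c b)))

powerCoeff-zero : ∀ B (c r : Type d) → powerCoeff B 0 c r ≡ (if does (c ≟ᵛ r) then 1 else 0)
powerCoeff-zero []      c r = refl
powerCoeff-zero (b ∷ B) c r =
  trans (+-identityʳ _) (trans (powerCoeff-∷-zeroth b B 0 c r) (powerCoeff-zero B c r))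

powerCoeff-unreachable : ∀ B s (c r : Type d) → (∀ x → c +ᵛ x ≢ r) → powerCoeff B s c r ≡ 0
powerCoeff-unreachable [] s c r unreachable with c ≟ᵛ r
... | yes c≡r = ⊥-elim (unreachable 0ᵛ (trans (+ᵛ-identityʳ c) c≡r))
... | no  _   = cong (if_then 1 else 0) (∧-zeroʳ (does (0 ≟ s)))
powerCoeff-unreachable (b ∷ B) s c r unreachable = ∑-zero (upTo (suc s)) vanish
  where
  vanish : ∀ a → (s C a) * (HC b ^ a * powerCoeff B (s ∸ a) (c +ᵛ a ·ᵛ b) r) ≡ 0
  vanish a rewrite powerCoeff-unreachable B (s ∸ a) (c +ᵛ a ·ᵛ b) r
                     (λ x eq → unreachable (a ·ᵛ b +ᵛ x) (trans (sym (+ᵛ-assoc c (a ·ᵛ b) x)) eq))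
                 | *-zeroʳ (HC b ^ a) = *-zeroʳ (s C a)

+ᵛ-swapʳ : (u v w : Type d) → u +ᵛ v +ᵛ w ≡ u +ᵛ w +ᵛ v
+ᵛ-swapʳ u v w = trans (+ᵛ-assoc u v w) (trans (cong (u +ᵛ_) (+ᵛ-comm v w)) (sym (+ᵛ-assoc u w v)))

module _ (b : Type d) (B : List (Type d)) (s : ℕ) (c r : Type d) where

  private
    X : ℕ → ℕ
    X a = HC b ^ suc a * powerCoeff B (s ∸ a) (c +ᵛ suc a ·ᵛ b) r

  powerCoeff-∷-pascal : powerCoeff (b ∷ B) (suc s) c r
                        ≡ powerCoeff B (suc s) c r
                          + (∑[ a ∈ upTo (suc s) ] ((s C a) * X a) + ∑[ a ∈ upTo (suc s) ] ((s C suc a) * X a))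
  powerCoeff-∷-pascal = begin
    powerCoeff (b ∷ B) (suc s) c r
      ≡⟨ ∑-upTo-suc (suc s) (λ a → (suc s C a) * (HC b ^ a * powerCoeff B (suc s ∸ a) (c +ᵛ a ·ᵛ b) r)) ⟩
    1 * (HC b ^ 0 * powerCoeff B (suc s) (c +ᵛ 0 ·ᵛ b) r) + ∑[ a ∈ upTo (suc s) ] ((suc s C suc a) * X a)
      ≡⟨ cong₂ _+_ (powerCoeff-∷-zeroth b B (suc s) c r)
                   (∑-cong (upTo (suc s)) (λ a → cong (_* X a) (sym (nCk+nC[k+1]≡[n+1]C[k+1] s a)))) ⟩
    powerCoeff B (suc s) c r + ∑[ a ∈ upTo (suc s) ] (((s C a) + (s C suc a)) * X a)
      ≡⟨ cong (powerCoeff B (suc s) c r +_)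
              (trans (∑-cong (upTo (suc s)) (λ a → *-distribʳ-+ (X a) (s C a) (s C suc a)))
                     (∑-distrib-+ (upTo (suc s)) (λ a → (s C a) * X a) (λ a → (s C suc a) * X a))) ⟩
    powerCoeff B (suc s) c r
      + (∑[ a ∈ upTo (suc s) ] ((s C a) * X a) + ∑[ a ∈ upTo (suc s) ] ((s C suc a) * X a)) ∎

  powerCoeff-∷-head : HC b * powerCoeff (b ∷ B) s (c +ᵛ b) r ≡ ∑[ a ∈ upTo (suc s) ] ((s C a) * X a)
  powerCoeff-∷-head =
    trans (*-distribˡ-∑ (upTo (suc s)) (HC b) (λ a → (s C a) * (HC b ^ a * powerCoeff B (s ∸ a) (c +ᵛ b +ᵛ a ·ᵛ b) r)))
          (∑-cong (upTo (suc s)) absorb)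
    where
    absorb : ∀ a → HC b * ((s C a) * (HC b ^ a * powerCoeff B (s ∸ a) (c +ᵛ b +ᵛ a ·ᵛ b) r)) ≡ (s C a) * X a
    absorb a = trans (solve 4 (λ w k p v → w :* (k :* (p :* v)) := k :* (w :* p :* v))
                              refl (HC b) (s C a) (HC b ^ a) (powerCoeff B (s ∸ a) (c +ᵛ b +ᵛ a ·ᵛ b) r))
                     (cong (λ v → (s C a) * (HC b ^ suc a * powerCoeff B (s ∸ a) v r))
                           (trans (+ᵛ-assoc c b (a ·ᵛ b)) (cong (c +ᵛ_) (sym (suc·ᵛ a b)))))

  powerCoeff-∷-tail : (∀ s′ c′ → powerCoeff B (suc s′) c′ r
                                 ≡ ∑[ b′ ∈ B ] (HC b′ * powerCoeff B s′ (c′ +ᵛ b′) r)) →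
                      ∑[ b′ ∈ B ] (HC b′ * powerCoeff (b ∷ B) s (c +ᵛ b′) r)
                      ≡ powerCoeff B (suc s) c r + ∑[ a ∈ upTo (suc s) ] ((s C suc a) * X a)
  powerCoeff-∷-tail pascal = begin
    ∑[ b′ ∈ B ] (HC b′ * powerCoeff (b ∷ B) s (c +ᵛ b′) r)
      ≡⟨ ∑-cong B (λ b′ → trans (*-distribˡ-∑ (upTo (suc s)) (HC b′) _) (∑-cong (upTo (suc s)) (reorder b′))) ⟩
    ∑[ b′ ∈ B ] ∑[ a ∈ upTo (suc s) ] ((s C a) * (HC b ^ a * (HC b′ * powerCoeff B (s ∸ a) (c +ᵛ a ·ᵛ b +ᵛ b′) r)))
      ≡⟨ ∑-comm B (upTo (suc s)) _ ⟩
    ∑[ a ∈ upTo (suc s) ] ∑[ b′ ∈ B ] ((s C a) * (HC b ^ a * (HC b′ * powerCoeff B (s ∸ a) (c +ᵛ a ·ᵛ b +ᵛ b′) r)))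
      ≡⟨ ∑-cong (upTo (suc s)) (λ a → trans (sym (*-distribˡ-∑ B (s C a) _))
                                            (cong ((s C a) *_) (sym (*-distribˡ-∑ B (HC b ^ a) _)))) ⟩
    ∑[ a ∈ upTo (suc s) ] ((s C a) * (HC b ^ a * ∑[ b′ ∈ B ] (HC b′ * powerCoeff B (s ∸ a) (c +ᵛ a ·ᵛ b +ᵛ b′) r)))
      ≡⟨ ∑-cong (upTo (suc s)) (λ a → cong (λ n → (s C a) * (HC b ^ a * n)) (pascal (s ∸ a) (c +ᵛ a ·ᵛ b))) ⟨
    ∑ (upTo (suc s)) Y
      ≡⟨ ∑-upTo-suc s Y ⟩
    Y 0 + ∑[ a ∈ upTo s ] Y (suc a)
      ≡⟨ cong₂ _+_ (powerCoeff-∷-zeroth b B (suc s) c r) (∑-upTo-cong s Y-suc) ⟩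
    powerCoeff B (suc s) c r + ∑[ a ∈ upTo s ] ((s C suc a) * X a)
      ≡⟨ cong (powerCoeff B (suc s) c r +_)
              (∑-upTo-extend (λ a → (s C suc a) * X a) (n≤1+n s) (λ a s≤a → cong (_* X a) (k>n⇒nCk≡0 (s≤s s≤a)))) ⟨
    powerCoeff B (suc s) c r + ∑[ a ∈ upTo (suc s) ] ((s C suc a) * X a) ∎
    where
    Y : ℕ → ℕ
    Y a = (s C a) * (HC b ^ a * powerCoeff B (suc (s ∸ a)) (c +ᵛ a ·ᵛ b) r)

    Y-suc : ∀ a → a < s → Y (suc a) ≡ (s C suc a) * X a
    Y-suc a a<s =
      cong (λ n → (s C suc a) * (HC b ^ suc a * powerCoeff B n (c +ᵛ suc a ·ᵛ b) r)) (sym (+-∸-assoc 1 a<s))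

    reorder : ∀ b′ a → HC b′ * ((s C a) * (HC b ^ a * powerCoeff B (s ∸ a) (c +ᵛ b′ +ᵛ a ·ᵛ b) r))
                       ≡ (s C a) * (HC b ^ a * (HC b′ * powerCoeff B (s ∸ a) (c +ᵛ a ·ᵛ b +ᵛ b′) r))
    reorder b′ a = trans (solve 4 (λ h k p v → h :* (k :* (p :* v)) := k :* (p :* (h :* v)))
                                  refl (HC b′) (s C a) (HC b ^ a) (powerCoeff B (s ∸ a) (c +ᵛ b′ +ᵛ a ·ᵛ b) r))
                         (cong (λ v → (s C a) * (HC b ^ a * (HC b′ * powerCoeff B (s ∸ a) v r))) (+ᵛ-swapʳ c b′ (a ·ᵛ b)))

powerCoeff-suc : ∀ B s (c r : Type d) → powerCoeff B (suc s) c r ≡ ∑[ b′ ∈ B ] (HC b′ * powerCoeff B s (c +ᵛ b′) r)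
powerCoeff-suc []      s c r = refl
powerCoeff-suc (b ∷ B) s c r = begin
  powerCoeff (b ∷ B) (suc s) c r
    ≡⟨ powerCoeff-∷-pascal b B s c r ⟩
  powerCoeff B (suc s) c r + (F + G)
    ≡⟨ +-CS.x∙yz≈y∙xz (powerCoeff B (suc s) c r) F G ⟩
  F + (powerCoeff B (suc s) c r + G)
    ≡⟨ cong₂ _+_ (powerCoeff-∷-head b B s c r) (powerCoeff-∷-tail b B s c r (λ s′ c′ → powerCoeff-suc B s′ c′ r)) ⟨
  HC b * powerCoeff (b ∷ B) s (c +ᵛ b) r + ∑[ b′ ∈ B ] (HC b′ * powerCoeff (b ∷ B) s (c +ᵛ b′) r) ∎
  where
  F = ∑[ a ∈ upTo (suc s) ] ((s C a) * (HC b ^ suc a * powerCoeff B (s ∸ a) (c +ᵛ suc a ·ᵛ b) r))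
  G = ∑[ a ∈ upTo (suc s) ] ((s C suc a) * (HC b ^ suc a * powerCoeff B (s ∸ a) (c +ᵛ suc a ·ᵛ b) r))

powerCoeff-box : ∀ s (c t r : Type d) → c +ᵛ t ≡ r → powerCoeff (box r) s c r ≡ Spow s t
powerCoeff-box zero c t r c+t≡r =
  trans (powerCoeff-zero (box r) c r) (cong (if_then 1 else 0) (does-⇔ (mk⇔ to from) (c ≟ᵛ r) (t ≟ᵛ 0ᵛ)))
  where
  to : c ≡ r → t ≡ 0ᵛ
  to c≡r = +ᵛ-cancelˡ c t 0ᵛ (trans c+t≡r (trans (sym c≡r) (sym (+ᵛ-identityʳ c))))
  from : t ≡ 0ᵛ → c ≡ r
  from t≡0 = trans (sym (+ᵛ-identityʳ c)) (trans (cong (c +ᵛ_) (sym t≡0)) c+t≡r)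
powerCoeff-box (suc s) c t r c+t≡r = begin
  powerCoeff (box r) (suc s) c r
    ≡⟨ powerCoeff-suc (box r) s c r ⟩
  ∑[ b ∈ box r ] (HC b * powerCoeff (box r) s (c +ᵛ b) r)
    ≡⟨ ∑-cong (box r) term ⟩
  ∑[ b ∈ box r ] (if does (b ≤ᵛ? t) then HC b * Spow s (t ∸ᵛ b) else 0)
    ≡⟨ ∑-box-≤ᵛ t≤r (λ b → HC b * Spow s (t ∸ᵛ b)) ⟩
  ∑[ b ∈ box t ] (HC b * Spow s (t ∸ᵛ b))
    ≡⟨ ∑-cong (box t) (λ b → cong (_* Spow s (t ∸ᵛ b)) (HC≡Spow1 b)) ⟩
  ∑[ b ∈ box t ] (Spow 1 b * Spow s (t ∸ᵛ b))
    ≡⟨ Spow-+ 1 s t ⟨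
  Spow (suc s) t ∎
  where
  t≤r : t ≤ᵛ r
  t≤r = subst (t ≤ᵛ_) (trans (+ᵛ-comm t c) c+t≡r) (u≤ᵛu+ᵛv t c)

  term : ∀ b → HC b * powerCoeff (box r) s (c +ᵛ b) r ≡ (if does (b ≤ᵛ? t) then HC b * Spow s (t ∸ᵛ b) else 0)
  term b with b ≤ᵛ? t
  ... | yes b≤t = cong (HC b *_) (powerCoeff-box s (c +ᵛ b) (t ∸ᵛ b) r
                                   (trans (+ᵛ-assoc c b (t ∸ᵛ b)) (trans (cong (c +ᵛ_) (u+ᵛ[v∸ᵛu]≡v b≤t)) c+t≡r)))
  ... | no  b≰t = trans (cong (HC b *_) (powerCoeff-unreachable (box r) s (c +ᵛ b) r unreachable)) (*-zeroʳ (HC b))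
    where
    unreachable : ∀ x → c +ᵛ b +ᵛ x ≢ r
    unreachable x eq = b≰t (subst (b ≤ᵛ_) (+ᵛ-cancelˡ c (b +ᵛ x) t (trans (sym (+ᵛ-assoc c b x)) (trans eq (sym c+t≡r))))
                                  (u≤ᵛu+ᵛv b x))

multinomialTerm : ℕ → Type d → Type d → List (Type d) → List ℕ → ℕ
multinomialTerm s c r B ks =
  if does ((sum ks ≟ s) ×-dec (c +ᵛ weighted ks B ≟ᵛ r))
  then multinomial s ks * product (zipWith (λ k n → HC n ^ k) ks B)
  else 0

multinomialTerm-∷ : ∀ s (c r b : Type d) B a ks →
                    multinomialTerm s c r (b ∷ B) (a ∷ ks)
                    ≡ (s C a) * (HC b ^ a * multinomialTerm (s ∸ a) (c +ᵛ a ·ᵛ b) r B ks)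
multinomialTerm-∷ s c r b B a ks with a ≤? s
... | no a≰s = begin
  multinomialTerm s c r (b ∷ B) (a ∷ ks)
    ≡⟨ cong (λ p → if p ∧ does (c +ᵛ weighted (a ∷ ks) (b ∷ B) ≟ᵛ r) then multinomial s (a ∷ ks) * Π else 0)
            (dec-false (a + sum ks ≟ s) (λ eq → a≰s (subst (a ≤_) eq (m≤m+n a (sum ks))))) ⟩
  0
    ≡⟨ cong (_* (HC b ^ a * multinomialTerm (s ∸ a) (c +ᵛ a ·ᵛ b) r B ks)) (k>n⇒nCk≡0 (≰⇒> a≰s)) ⟨
  (s C a) * (HC b ^ a * multinomialTerm (s ∸ a) (c +ᵛ a ·ᵛ b) r B ks) ∎
  where
  Π = HC b ^ a * product (zipWith (λ k n → HC n ^ k) ks B)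
... | yes a≤s = begin
  multinomialTerm s c r (b ∷ B) (a ∷ ks)
    ≡⟨ cong₂ (λ p q → if p ∧ q then multinomial s (a ∷ ks) * (HC b ^ a * Π) else 0) sumCondition vectorCondition ⟩
  (if does (sum ks ≟ s ∸ a) ∧ does (c +ᵛ a ·ᵛ b +ᵛ w ≟ᵛ r) then multinomial s (a ∷ ks) * (HC b ^ a * Π) else 0)
    ≡⟨ factor (sum ks ≟ s ∸ a) (c +ᵛ a ·ᵛ b +ᵛ w ≟ᵛ r) ⟩
  (s C a) * (HC b ^ a * multinomialTerm (s ∸ a) (c +ᵛ a ·ᵛ b) r B ks) ∎
  where
  w = weighted ks B
  Π = product (zipWith (λ k n → HC n ^ k) ks B)

  sumCondition : does (a + sum ks ≟ s) ≡ does (sum ks ≟ s ∸ a)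
  sumCondition = does-⇔ (mk⇔ (λ eq → trans (sym (m+n∸m≡n a (sum ks))) (cong (_∸ a) eq))
                             (λ eq → trans (cong (a +_) eq) (m+[n∸m]≡n a≤s)))
                        (a + sum ks ≟ s) (sum ks ≟ s ∸ a)

  vectorCondition : does (c +ᵛ (a ·ᵛ b +ᵛ w) ≟ᵛ r) ≡ does (c +ᵛ a ·ᵛ b +ᵛ w ≟ᵛ r)
  vectorCondition = cong (λ v → does (v ≟ᵛ r)) (sym (+ᵛ-assoc c (a ·ᵛ b) w))

  vanishing : (s C a) * (HC b ^ a * 0) ≡ 0
  vanishing = trans (cong ((s C a) *_) (*-zeroʳ (HC b ^ a))) (*-zeroʳ (s C a))

  factor : (p : Dec (sum ks ≡ s ∸ a)) (q : Dec (c +ᵛ a ·ᵛ b +ᵛ w ≡ r)) →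
           (if does p ∧ does q then multinomial s (a ∷ ks) * (HC b ^ a * Π) else 0)
           ≡ (s C a) * (HC b ^ a * (if does p ∧ does q then multinomial (s ∸ a) ks * Π else 0))
  factor (yes ks-sum) (yes _) = begin
    multinomial s (a ∷ ks) * (HC b ^ a * Π)       ≡⟨ cong (_* (HC b ^ a * Π)) (multinomial-∷ ks a≤s ks-sum) ⟩
    (s C a) * M * (HC b ^ a * Π)                  ≡⟨ solve 4 (λ k m h p → k :* m :* (h :* p) := k :* (h :* (m :* p)))
                                                           refl (s C a) M (HC b ^ a) Π ⟩
    (s C a) * (HC b ^ a * (M * Π))                ∎
    where M = multinomial (s ∸ a) ks
  factor (yes _) (no _) = sym vanishing
  factor (no _)  _      = sym vanishing

∑-lists≤-multinomialTerm : ∀ J B s (c r : Type d) → s ≤ J →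
                           ∑ (lists≤ J (length B)) (multinomialTerm s c r B) ≡ powerCoeff B s c r
∑-lists≤-multinomialTerm J []      zero    c r _ =
  trans (+-identityʳ _) (cong (λ v → if does (v ≟ᵛ r) then 1 else 0) (+ᵛ-identityʳ c))
∑-lists≤-multinomialTerm J []      (suc s) c r _ = refl
∑-lists≤-multinomialTerm J (b ∷ B) s       c r s≤J = begin
  ∑ (lists≤ J (suc (length B))) (multinomialTerm s c r (b ∷ B))
    ≡⟨ ∑-concatMap-map (upTo (suc J)) (lists≤ J (length B)) _∷_ (multinomialTerm s c r (b ∷ B)) ⟩
  ∑[ a ∈ upTo (suc J) ] ∑[ ks ∈ lists≤ J (length B) ] multinomialTerm s c r (b ∷ B) (a ∷ ks)
    ≡⟨ ∑-cong (upTo (suc J)) column ⟩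
  ∑ (upTo (suc J)) term
    ≡⟨ ∑-upTo-extend term (s≤s s≤J) vanish ⟩
  powerCoeff (b ∷ B) s c r ∎
  where
  term : ℕ → ℕ
  term a = (s C a) * (HC b ^ a * powerCoeff B (s ∸ a) (c +ᵛ a ·ᵛ b) r)

  vanish : ∀ a → suc s ≤ a → term a ≡ 0
  vanish a s<a = cong (_* (HC b ^ a * powerCoeff B (s ∸ a) (c +ᵛ a ·ᵛ b) r)) (k>n⇒nCk≡0 s<a)

  column : ∀ a → ∑[ ks ∈ lists≤ J (length B) ] multinomialTerm s c r (b ∷ B) (a ∷ ks) ≡ term a
  column a = begin
    ∑[ ks ∈ lists≤ J (length B) ] multinomialTerm s c r (b ∷ B) (a ∷ ks)
      ≡⟨ ∑-cong (lists≤ J (length B)) (multinomialTerm-∷ s c r b B a) ⟩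
    ∑[ ks ∈ lists≤ J (length B) ] ((s C a) * (HC b ^ a * multinomialTerm (s ∸ a) (c +ᵛ a ·ᵛ b) r B ks))
      ≡⟨ *-distribˡ-∑ (lists≤ J (length B)) (s C a) _ ⟨
    (s C a) * ∑[ ks ∈ lists≤ J (length B) ] (HC b ^ a * multinomialTerm (s ∸ a) (c +ᵛ a ·ᵛ b) r B ks)
      ≡⟨ cong ((s C a) *_) (*-distribˡ-∑ (lists≤ J (length B)) (HC b ^ a) _) ⟨
    (s C a) * (HC b ^ a * ∑ (lists≤ J (length B)) (multinomialTerm (s ∸ a) (c +ᵛ a ·ᵛ b) r B))
      ≡⟨ cong (λ n → (s C a) * (HC b ^ a * n))
              (∑-lists≤-multinomialTerm J B (s ∸ a) (c +ᵛ a ·ᵛ b) r (≤-trans (m∸n≤m s a) s≤J)) ⟩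
    term a ∎

innerSum≡Spow : ∀ j (r : Type d) → innerSum j r ≡ Spow j r
innerSum≡Spow j r = begin
  innerSum j r
    ≡⟨ ∑-filter _ (lists≤ j (length (box r))) _ ⟩
  ∑[ ks ∈ lists≤ j (length (box r)) ]
    (if does ((sum ks ≟ j) ×-dec (weighted ks (box r) ≟ᵛ r)) then multinomial j ks * Π ks else 0)
    ≡⟨ ∑-cong (lists≤ j (length (box r)))
              (λ ks → cong (λ v → if does ((sum ks ≟ j) ×-dec (v ≟ᵛ r)) then multinomial j ks * Π ks else 0)
                           (sym (+ᵛ-identityˡ (weighted ks (box r))))) ⟩
  ∑ (lists≤ j (length (box r))) (multinomialTerm j 0ᵛ r (box r))
    ≡⟨ ∑-lists≤-multinomialTerm j (box r) j 0ᵛ r ≤-refl ⟩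
  powerCoeff (box r) j 0ᵛ r
    ≡⟨ powerCoeff-box j 0ᵛ r r (+ᵛ-identityˡ r) ⟩
  Spow j r ∎
  where
  Π : List ℕ → ℕ
  Π ks = product (zipWith (λ k n → HC n ^ k) ks (box r))

innerSum?≡Spow : ∀ j (x : Maybe (Type d)) → innerSum? j x ≡ maybe′ (Spow j) 0 x
innerSum?≡Spow j (just r) = innerSum≡Spow j r
innerSum?≡Spow j nothing  = refl

hyperCatalan-recurrence : ∀ d (m : Vec ℕ d) → m ≢ replicate d 0 → HC m ≡ RHS m
hyperCatalan-recurrence d m m≢0 = begin
  HC m
    ≡⟨ HC≡Spow1 m ⟩
  Spow 1 m
    ≡⟨ Spow-suc 0 m ⟩
  Spow 0 m + ∑[ i ∈ allFin d ] maybe′ (Spow (toℕ i + 2)) 0 (minusUnit m i)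
    ≡⟨ cong (_+ ∑[ i ∈ allFin d ] maybe′ (Spow (toℕ i + 2)) 0 (minusUnit m i)) (Spow-0-≢0ᵛ m≢0) ⟩
  ∑[ i ∈ allFin d ] maybe′ (Spow (toℕ i + 2)) 0 (minusUnit m i)
    ≡⟨ ∑-cong (allFin d) (λ i → innerSum?≡Spow (toℕ i + 2) (minusUnit m i)) ⟨
  RHS m ∎

theorem2 : (HC {0} [] ≡ 1)
         × (∀ (d : ℕ) (m : Vec ℕ d) → m ≢ replicate d 0 → HC m ≡ RHS m)
theorem2 = refl , hyperCatalan-recurrence
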